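{- Let $R$ be a trunk (a partially colored tree in which every colored vertex is a leaf) with at most one colored vertex and with at most $7$ vertices. Then Alice has a winning strategy in the $3$-Modified Coloring Game on $R$.
   Context: The $k$-coloring game on a (possibly partially colored, properly) graph with a set of $k$ colors: a color is legal for a vertex $v$ if no neighbor of $v$ has that color. Alice and Bob alternately color uncolored vertices with legal colors, Alice moving first. If at any point some uncolored vertex has no legal color, Bob wins; Alice wins once every vertex is colored. The $k$-Modified Coloring Game is the same game except that Bob moves first and Bob may choose to pass on any turn. For a partially colored forest $F$, a trunk of $F$ is a maximal connected subgraph of $F$ in which every colored vertex is a leaf. -}

module Defs where

open import Data.Nat using (ℕ; zero; suc; _≤_; _<_)
open import Data.Fin using (Fin)
open import Data.Bool using (Bool; true; false)
open import Data.Maybe using (Maybe; just; nothing)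
open import Data.List using (List; []; _∷_; length; filterᵇ; allFin)
open import Data.List.Relation.Unary.Unique.Propositional using (Unique)
open import Data.Product using (Σ; _×_; _,_; ∃)
open import Relation.Nullary using (¬_)
open import Data.Unit using (⊤)
open import Data.Empty using (⊥)
open import Relation.Binary.PropositionalEquality using (_≡_; _≢_)
open import Data.Fin using (_≟_)
open import Relation.Nullary.Decidable using (⌊_⌋)

record Graph (n : ℕ) : Set where
  field
    adj   : Fin n → Fin n → Bool
    sym   : ∀ u v → adj u v ≡ adj v u
    irrefl : ∀ v → adj v v ≡ false
open Graph public

data Walk {n : ℕ} (G : Graph n) : Fin n → Fin n → Set where
  here  : ∀ v → Walk G v v
  step  : ∀ {u v w} → adj G u v ≡ true → Walk G v w → Walk G u w

Connected : ∀ {n} → Graph n → Set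
Connected {n} G = ∀ (u v : Fin n) → Walk G u v

Chain : ∀ {n} → Graph n → List (Fin n) → Set
Chain G []            = ⊤
Chain G (x ∷ [])      = ⊤
Chain G (x ∷ y ∷ xs)  = (adj G x y ≡ true) × Chain G (y ∷ xs)

ClosesTo : ∀ {n} → Graph n → Fin n → List (Fin n) → Set
ClosesTo G x []           = ⊥
ClosesTo G x (y ∷ [])     = adj G y x ≡ true
ClosesTo G x (y ∷ z ∷ zs) = ClosesTo G x (z ∷ zs)

IsCycle : ∀ {n} → Graph n → List (Fin n) → Set
IsCycle G []       = ⊥
IsCycle G (x ∷ xs) =
  (3 ≤ length (x ∷ xs)) × Unique (x ∷ xs) × Chain G (x ∷ xs) × ClosesTo G x xs

Acyclic : ∀ {n} → Graph n → Set
Acyclic {n} G = ∀ (cs : List (Fin n)) → ¬ IsCycle G cs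

Tree : ∀ {n} → Graph n → Set
Tree {n} G = (1 ≤ n) × Connected G × Acyclic G

degree : ∀ {n} → Graph n → Fin n → ℕ
degree {n} G v = length (filterᵇ (adj G v) (allFin n))

IsLeaf : ∀ {n} → Graph n → Fin n → Set
IsLeaf G v = degree G v ≡ 1

-- Partial colorings with colors Fin k; nothing = uncolored.
Coloring : ℕ → ℕ → Set
Coloring n k = Fin n → Maybe (Fin k)

Proper : ∀ {n k} → Graph n → Coloring n k → Set
Proper {n} G c = ∀ (u v : Fin n) (a : _) → adj G u v ≡ true →
  c u ≡ just a → c v ≢ just a

Legal : ∀ {n k} → Graph n → Coloring n k → Fin n → Fin k → Set
Legal {n} G c v a = ∀ (u : Fin n) → adj G v u ≡ true → c u ≢ just a

Complete : ∀ {n k} → Coloring n k → Set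
Complete {n} c = ∀ (v : Fin n) → c v ≢ nothing

NoDead : ∀ {n k} → Graph n → Coloring n k → Set
NoDead {n} {k} G c = ∀ (v : Fin n) → c v ≡ nothing → ∃ λ (a : Fin k) → Legal G c v a

update : ∀ {n k} → Coloring n k → Fin n → Fin k → Coloring n k
update c v a u with u ≟ v
... | Relation.Nullary.yes _ = just a
... | Relation.Nullary.no  _ = c u

-- The k-Modified Coloring Game (Bob moves first, Bob may pass).
-- AliceWinsA G c : Alice is to move in position c and has a winning strategy.
-- AliceWinsB G c : Bob is to move in position c and Alice has a winning strategy.
-- Bob wins as soon as some uncolored vertex has no legal color; Alice wins
-- once every vertex is colored.
mutual
  data AliceWinsA {n k : ℕ} (G : Graph n) (c : Coloring n k) : Set where
    doneA : Complete c → AliceWinsA G c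
    move  : NoDead G c → (v : Fin n) (a : Fin k) → c v ≡ nothing → Legal G c v a →
            AliceWinsB G (update c v a) → AliceWinsA G c

  data AliceWinsB {n k : ℕ} (G : Graph n) (c : Coloring n k) : Set where
    doneB : Complete c → AliceWinsB G c
    bobTurn : ¬ Complete c → NoDead G c →
              AliceWinsA G c →      -- Bob passes
              (∀ (v : Fin n) (a : Fin k) → c v ≡ nothing → Legal G c v a →
                 AliceWinsA G (update c v a)) →
              AliceWinsB G c

AliceWinsModified : ∀ {n} (k : ℕ) → (G : Graph n) → Coloring n k → Set
AliceWinsModified k G c = AliceWinsB G c

IsTreeTrunk : ∀ {n k} → Graph n → Coloring n k → Set
IsTreeTrunk {n} G c = Tree G × Proper G c ×
  (∀ (v : Fin n) (a : _) → c v ≡ just a → IsLeaf G v)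

AtMostOneColored : ∀ {n k} → Coloring n k → Set
AtMostOneColored {n} c = ∀ (u v : Fin n) → c u ≢ nothing → c v ≢ nothing → u ≡ v

module Submission where

-- Call a vertex with three distinct neighbours a hub.  Three hubs in a forest
-- force eight distinct vertices, so here there are at most two.  A vertex
-- is safe when its neighbourhood can never show more than two colours; then
-- it always has a legal colour, and once every uncoloured vertex is safe
-- Alice wins by playing anywhere.  Vertices of degree at most two are safe,
-- so only the hubs matter.
--   * One hub h: before Bob's turn Alice keeps h's neighbourhood to a single
--     colour; after Bob's move it shows at most two and Alice colours h.
--   * Two uncoloured hubs: Alice answers Bob's opening (a pass, a move on a
--     hub, or a move elsewhere, split by whether the hubs are adjacent) by
--     colouring a vertex after which the other hub sees a single colour and
--     everything else is safe, which is the one-hub situation again.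

open import Defs
open import Data.Nat using (ℕ; zero; suc; _+_; _≤_; _<_; z≤n; s≤s)
open import Data.Nat.Properties using (≤-pred; <-≤-trans; n<1+n; +-mono-≤; +-mono-≤-<)
open import Data.Fin using (Fin; zero; suc; _≟_)
open import Data.Fin.Properties using (pigeonhole; any?; <⇒≢)
open import Data.Bool using (true; false)
import Data.Bool.Properties as Bool
open import Data.Maybe using (Maybe; just; nothing; fromMaybe)
open import Data.Maybe.Properties using (just-injective)
open import Data.List using (List; []; _∷_; allFin)
open import Data.List.Relation.Unary.Any using (here; there)
open import Data.List.Relation.Unary.All using ([]; _∷_)
open import Data.List.Relation.Unary.AllPairs using ([]; _∷_)
open import Data.List.Membership.Propositional using (_∈_)
open import Data.List.Membership.Propositional.Properties using (∈-allFin)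
open import Data.Vec using (Vec; []; _∷_; lookup)
open import Data.Vec.Relation.Unary.All using ([]; _∷_)
open import Data.Vec.Relation.Unary.AllPairs using ([]; _∷_)
open import Data.Vec.Relation.Unary.Unique.Propositional using (Unique)
open import Data.Vec.Relation.Unary.Unique.Propositional.Properties using (lookup-injective)
open import Data.Product using (Σ; _×_; _,_; ∃; proj₁; proj₂)
open import Data.Sum using (_⊎_; inj₁; inj₂; swap)
open import Relation.Nullary using (¬_; Dec; yes; no)
open import Relation.Nullary.Decidable using (_×-dec_; ¬?)
open import Data.Unit using (tt)
open import Data.Empty using (⊥; ⊥-elim)
open import Relation.Binary.PropositionalEquality
  using (_≡_; _≢_; refl; trans; ≢-sym) renaming (sym to ≡-sym)

distinct-bound : ∀ {n m} (vs : Vec (Fin n) m) → n < m → ¬ Unique vs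
distinct-bound vs n<m distinct with pigeonhole n<m (lookup vs)
... | i , j , i<j , same = <⇒≢ i<j (lookup-injective distinct i j same)

module Adjacency {n : ℕ} (G : Graph n) where

  infix 4 _~_ _≁_
  _~_ _≁_ : Fin n → Fin n → Set
  u ~ v = adj G u v ≡ true
  u ≁ v = adj G u v ≡ false

  ~-sym : ∀ {u v} → u ~ v → v ~ u
  ~-sym {u} {v} uv = trans (Graph.sym G v u) uv

  ≁-sym : ∀ {u v} → u ≁ v → v ≁ u
  ≁-sym {u} {v} uv = trans (Graph.sym G v u) uv

  adj? : ∀ u v → Dec (u ~ v)
  adj? u v = adj G u v Bool.≟ true

  ¬~⇒≁ : ∀ {u v} → ¬ (u ~ v) → u ≁ v
  ¬~⇒≁ {u} {v} ¬uv with adj G u v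
  ... | false = refl
  ... | true  = ⊥-elim (¬uv refl)

  ~≁⇒≢ : ∀ {x a b} → x ~ a → x ≁ b → a ≢ b
  ~≁⇒≢ xa xb refl with () ← trans (≡-sym xa) xb

  ~⇒≢ : ∀ {u v} → u ~ v → u ≢ v
  ~⇒≢ {u} uv refl = ~≁⇒≢ uv (irrefl G u) refl

  DegAtMost2 : Fin n → Set
  DegAtMost2 v = Σ (Fin n) λ x → Σ (Fin n) λ y → ∀ u → v ~ u → u ≡ x ⊎ u ≡ y

  record Hub (v : Fin n) : Set where
    constructor hub
    field
      p q r    : Fin n
      vp       : v ~ p
      vq       : v ~ q
      vr       : v ~ r
      p≢q      : p ≢ q
      p≢r      : p ≢ r
      q≢r      : q ≢ r

  hub⇒¬deg2 : ∀ {v} → Hub v → ¬ DegAtMost2 v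
  hub⇒¬deg2 (hub p q r vp vq vr p≢q p≢r q≢r) (x , y , in-xy) =
    pigeon (in-xy p vp) (in-xy q vq) (in-xy r vr)
    where
    pigeon : p ≡ x ⊎ p ≡ y → q ≡ x ⊎ q ≡ y → r ≡ x ⊎ r ≡ y → ⊥
    pigeon (inj₁ refl) (inj₁ refl) _           = p≢q refl
    pigeon (inj₂ refl) (inj₂ refl) _           = p≢q refl
    pigeon (inj₁ refl) (inj₂ refl) (inj₁ refl) = p≢r refl
    pigeon (inj₁ refl) (inj₂ refl) (inj₂ refl) = q≢r refl
    pigeon (inj₂ refl) (inj₁ refl) (inj₁ refl) = q≢r refl
    pigeon (inj₂ refl) (inj₁ refl) (inj₂ refl) = p≢r refl

  deg2-or-hub : ∀ v → DegAtMost2 v ⊎ Hub v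
  deg2-or-hub v with any? (adj? v)
  ... | no none = inj₁ (v , v , λ u vu → ⊥-elim (none (u , vu)))
  ... | yes (p , vp) with any? (λ q → adj? v q ×-dec ¬? (q ≟ p))
  ...   | no none = inj₁ (p , p , λ u vu → inj₁ (only-p u vu))
    where
    only-p : ∀ u → v ~ u → u ≡ p
    only-p u vu with u ≟ p
    ... | yes u≡p = u≡p
    ... | no u≢p  = ⊥-elim (none (u , vu , u≢p))
  ...   | yes (q , vq , q≢p) with any? (λ r → adj? v r ×-dec (¬? (r ≟ p) ×-dec ¬? (r ≟ q)))
  ...     | yes (r , vr , r≢p , r≢q) = inj₂ (hub p q r vp vq vr (≢-sym q≢p) (≢-sym r≢p) (≢-sym r≢q))
  ...     | no none = inj₁ (p , q , only-pq)
    where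
    only-pq : ∀ u → v ~ u → u ≡ p ⊎ u ≡ q
    only-pq u vu with u ≟ p | u ≟ q
    ... | yes u≡p | _       = inj₁ u≡p
    ... | no _    | yes u≡q = inj₂ u≡q
    ... | no u≢p  | no u≢q  = ⊥-elim (none (u , vu , u≢p , u≢q))

  hub? : ∀ v → Dec (Hub v)
  hub? v with deg2-or-hub v
  ... | inj₁ low = no (λ h → hub⇒¬deg2 h low)
  ... | inj₂ h   = yes h

  ¬hub⇒deg2 : ∀ {v} → ¬ Hub v → DegAtMost2 v
  ¬hub⇒deg2 {v} ¬h with deg2-or-hub v
  ... | inj₁ low = low
  ... | inj₂ h   = ⊥-elim (¬h h)

  nbrs-among₃ : ∀ v s t f →
    (∀ u → v ~ u → u ≡ s ⊎ u ≡ t ⊎ u ≡ f) ⊎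
    (Σ (Fin n) λ g → v ~ g × g ≢ s × g ≢ t × g ≢ f)
  nbrs-among₃ v s t f with any? (λ g → adj? v g ×-dec (¬? (g ≟ s) ×-dec (¬? (g ≟ t) ×-dec ¬? (g ≟ f))))
  ... | yes (g , vg , g≢s , g≢t , g≢f) = inj₂ (g , vg , g≢s , g≢t , g≢f)
  ... | no none = inj₁ among
    where
    among : ∀ u → v ~ u → u ≡ s ⊎ u ≡ t ⊎ u ≡ f
    among u vu with u ≟ s | u ≟ t | u ≟ f
    ... | yes u≡s | _       | _       = inj₁ u≡s
    ... | no _    | yes u≡t | _       = inj₂ (inj₁ u≡t)
    ... | no _    | no _    | yes u≡f = inj₂ (inj₂ u≡f)
    ... | no u≢s  | no u≢t  | no u≢f  = ⊥-elim (none (u , vu , u≢s , u≢t , u≢f))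

  two-nbrs-avoiding : ∀ {v} → Hub v → (s : Fin n) →
    Σ (Fin n) λ a → Σ (Fin n) λ b → v ~ a × v ~ b × a ≢ b × a ≢ s × b ≢ s
  two-nbrs-avoiding (hub p q r vp vq vr p≢q p≢r q≢r) s with p ≟ s | q ≟ s
  ... | yes refl | _        = q , r , vq , vr , q≢r , ≢-sym p≢q , ≢-sym p≢r
  ... | no p≢s   | yes refl = p , r , vp , vr , p≢r , p≢s , ≢-sym q≢r
  ... | no p≢s   | no q≢s   = p , q , vp , vq , p≢q , p≢s , q≢s

  nbr-avoiding₂ : ∀ {v} → Hub v → (s t : Fin n) → Σ (Fin n) λ a → v ~ a × a ≢ s × a ≢ t
  nbr-avoiding₂ h s t with two-nbrs-avoiding h s
  ... | a , b , va , vb , a≢b , a≢s , b≢s with a ≟ t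
  ...   | yes refl = b , vb , b≢s , ≢-sym a≢b
  ...   | no a≢t   = a , va , a≢s , a≢t

-- Short cycles are excluded in a forest; this is all the acyclicity we use.
module Forest {n : ℕ} (G : Graph n) (acyclic : Acyclic G) where
  open Adjacency G

  no-triangle : ∀ {a b c} → a ~ b → b ~ c → c ~ a → ⊥
  no-triangle {a} {b} {c} ab bc ca = acyclic (a ∷ b ∷ c ∷ [])
    ( s≤s (s≤s (s≤s z≤n))
    , ((~⇒≢ ab ∷ ≢-sym (~⇒≢ ca) ∷ []) ∷ (~⇒≢ bc ∷ []) ∷ [] ∷ [])
    , (ab , bc , tt) , ca)

  no-square : ∀ {a b c d} → a ~ b → b ~ c → c ~ d → d ~ a → a ≢ c → b ≢ d → ⊥
  no-square {a} {b} {c} {d} ab bc cd da a≢c b≢d = acyclic (a ∷ b ∷ c ∷ d ∷ [])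
    ( s≤s (s≤s (s≤s z≤n))
    , ((~⇒≢ ab ∷ a≢c ∷ ≢-sym (~⇒≢ da) ∷ []) ∷ (~⇒≢ bc ∷ b≢d ∷ []) ∷ (~⇒≢ cd ∷ []) ∷ [] ∷ [])
    , (ab , bc , cd , tt) , da)

  edge-no-common-nbr : ∀ {h₁ h₂ x y} → h₁ ~ h₂ → h₁ ~ x → h₂ ~ y → x ≢ y
  edge-no-common-nbr h₁h₂ h₁x h₂y refl = no-triangle h₁x (~-sym h₂y) (~-sym h₁h₂)

  -- Two distinct vertices have at most one common neighbour: of two distinct
  -- neighbours a, b of z, a vertex x ≢ z misses one.
  misses-one-of : ∀ {x z a b} → x ≢ z → z ~ a → z ~ b → a ≢ b → x ≁ a ⊎ x ≁ b
  misses-one-of {x} {z} {a} {b} x≢z za zb a≢b with adj? x a | adj? x b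
  ... | no ¬xa | _      = inj₁ (¬~⇒≁ ¬xa)
  ... | yes _  | no ¬xb = inj₂ (¬~⇒≁ ¬xb)
  ... | yes xa | yes xb = ⊥-elim (no-square xa (~-sym za) zb (~-sym xb) x≢z a≢b)

  two-nbrs-away-from : ∀ {x y} → x ≢ y → Hub y →
    Σ (Fin n) λ a → Σ (Fin n) λ b → y ~ a × y ~ b × a ≢ b × x ≁ a × x ≁ b
  two-nbrs-away-from x≢y (hub p q r yp yq yr p≢q p≢r q≢r)
    with misses-one-of x≢y yp yq p≢q
  ... | inj₁ xp with misses-one-of x≢y yq yr q≢r
  ...   | inj₁ xq = p , q , yp , yq , p≢q , xp , xq
  ...   | inj₂ xr = p , r , yp , yr , p≢r , xp , xr
  two-nbrs-away-from x≢y (hub p q r yp yq yr p≢q p≢r q≢r)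
      | inj₂ xq with misses-one-of x≢y yp yr p≢r
  ...   | inj₁ xp = p , q , yp , yq , p≢q , xp , xq
  ...   | inj₂ xr = q , r , yq , yr , q≢r , xq , xr

  nbr-away-from₂ : ∀ {x y z} → x ≢ z → y ≢ z → Hub z →
    Σ (Fin n) λ k → z ~ k × x ≁ k × y ≁ k
  nbr-away-from₂ x≢z y≢z hz with two-nbrs-away-from x≢z hz
  ... | a , b , za , zb , a≢b , xa , xb with misses-one-of y≢z za zb a≢b
  ...   | inj₁ ya = a , za , xa , ya
  ...   | inj₂ yb = b , zb , xb , yb

  -- With at most seven vertices there are no three distinct hubs: in each
  -- configuration of three hubs x, y, z we exhibit eight distinct vertices.
  module HubCount (small : n ≤ 7) where

    eight-distinct : ∀ {a b c d e f g h : Fin n} → ¬ Unique (a ∷ b ∷ c ∷ d ∷ e ∷ f ∷ g ∷ h ∷ [])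
    eight-distinct = distinct-bound _ (s≤s small)

    -- x ~ y ~ z: two further neighbours each of x and z, and one of y.
    hubs-on-path : ∀ {x y z} → x ~ y → y ~ z → x ≁ z → x ≢ z → Hub x → Hub y → Hub z → ⊥
    hubs-on-path {x} {y} {z} xy yz xz x≢z hx hy hz
      with two-nbrs-avoiding hx y | nbr-avoiding₂ hy x z | two-nbrs-avoiding hz y
    ... | x₁ , x₂ , xx₁ , xx₂ , x₁≢x₂ , x₁≢y , x₂≢y | y₁ , yy₁ , y₁≢x , y₁≢z
        | z₁ , z₂ , zz₁ , zz₂ , z₁≢z₂ , z₁≢y , z₂≢y =
      eight-distinct {x} {y} {z} {x₁} {x₂} {y₁} {z₁} {z₂}
        ( (~⇒≢ xy ∷ x≢z ∷ ~⇒≢ xx₁ ∷ ~⇒≢ xx₂ ∷ ≢-sym y₁≢x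
            ∷ ≢-sym (~≁⇒≢ zz₁ (≁-sym xz)) ∷ ≢-sym (~≁⇒≢ zz₂ (≁-sym xz)) ∷ [])
        ∷ (~⇒≢ yz ∷ ≢-sym x₁≢y ∷ ≢-sym x₂≢y ∷ ~⇒≢ yy₁ ∷ ≢-sym z₁≢y ∷ ≢-sym z₂≢y ∷ [])
        ∷ (≢-sym (~≁⇒≢ xx₁ xz) ∷ ≢-sym (~≁⇒≢ xx₂ xz) ∷ ≢-sym y₁≢z ∷ ~⇒≢ zz₁ ∷ ~⇒≢ zz₂ ∷ [])
        ∷ (x₁≢x₂ ∷ edge-no-common-nbr xy xx₁ yy₁
            ∷ (λ { refl → no-square xy yz zz₁ (~-sym xx₁) x≢z (≢-sym x₁≢y) })
            ∷ (λ { refl → no-square xy yz zz₂ (~-sym xx₁) x≢z (≢-sym x₁≢y) }) ∷ [])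
        ∷ (edge-no-common-nbr xy xx₂ yy₁
            ∷ (λ { refl → no-square xy yz zz₁ (~-sym xx₂) x≢z (≢-sym x₂≢y) })
            ∷ (λ { refl → no-square xy yz zz₂ (~-sym xx₂) x≢z (≢-sym x₂≢y) }) ∷ [])
        ∷ (edge-no-common-nbr yz yy₁ zz₁ ∷ edge-no-common-nbr yz yy₁ zz₂ ∷ [])
        ∷ (z₁≢z₂ ∷ [])
        ∷ [] ∷ [])

    -- x ~ y, z apart: two further neighbours each of x and y, one of z.
    hubs-edge-apart : ∀ {x y z} → x ~ y → x ≁ z → y ≁ z → x ≢ z → y ≢ z →
      Hub x → Hub y → Hub z → ⊥
    hubs-edge-apart {x} {y} {z} xy xz yz x≢z y≢z hx hy hz
      with two-nbrs-avoiding hx y | two-nbrs-avoiding hy x | nbr-away-from₂ x≢z y≢z hz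
    ... | x₁ , x₂ , xx₁ , xx₂ , x₁≢x₂ , x₁≢y , x₂≢y
        | y₁ , y₂ , yy₁ , yy₂ , y₁≢y₂ , y₁≢x , y₂≢x | k , zk , xk , yk =
      eight-distinct {x} {y} {z} {x₁} {x₂} {y₁} {y₂} {k}
        ( (~⇒≢ xy ∷ x≢z ∷ ~⇒≢ xx₁ ∷ ~⇒≢ xx₂ ∷ ≢-sym y₁≢x ∷ ≢-sym y₂≢x
            ∷ ≢-sym (~≁⇒≢ zk (≁-sym xz)) ∷ [])
        ∷ (y≢z ∷ ≢-sym x₁≢y ∷ ≢-sym x₂≢y ∷ ~⇒≢ yy₁ ∷ ~⇒≢ yy₂
            ∷ ≢-sym (~≁⇒≢ zk (≁-sym yz)) ∷ [])
        ∷ (≢-sym (~≁⇒≢ xx₁ xz) ∷ ≢-sym (~≁⇒≢ xx₂ xz) ∷ ≢-sym (~≁⇒≢ yy₁ yz)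
            ∷ ≢-sym (~≁⇒≢ yy₂ yz) ∷ ~⇒≢ zk ∷ [])
        ∷ (x₁≢x₂ ∷ edge-no-common-nbr xy xx₁ yy₁ ∷ edge-no-common-nbr xy xx₁ yy₂ ∷ ~≁⇒≢ xx₁ xk ∷ [])
        ∷ (edge-no-common-nbr xy xx₂ yy₁ ∷ edge-no-common-nbr xy xx₂ yy₂ ∷ ~≁⇒≢ xx₂ xk ∷ [])
        ∷ (y₁≢y₂ ∷ ~≁⇒≢ yy₁ yk ∷ [])
        ∷ (~≁⇒≢ yy₂ yk ∷ [])
        ∷ [] ∷ [])

    -- x, y, z pairwise apart: three neighbours of x, two of y away from x.
    hubs-apart : ∀ {x y z} → x ≁ y → x ≁ z → y ≁ z → x ≢ y → x ≢ z → y ≢ z →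
      Hub x → Hub y → Hub z → ⊥
    hubs-apart {x} {y} {z} xy xz yz x≢y x≢z y≢z (hub p q r xp xq xr p≢q p≢r q≢r) hy _
      with two-nbrs-away-from x≢y hy
    ... | a , b , ya , yb , a≢b , xa , xb =
      eight-distinct {x} {y} {z} {p} {q} {r} {a} {b}
        ( (x≢y ∷ x≢z ∷ ~⇒≢ xp ∷ ~⇒≢ xq ∷ ~⇒≢ xr
            ∷ ≢-sym (~≁⇒≢ ya (≁-sym xy)) ∷ ≢-sym (~≁⇒≢ yb (≁-sym xy)) ∷ [])
        ∷ (y≢z ∷ ≢-sym (~≁⇒≢ xp xy) ∷ ≢-sym (~≁⇒≢ xq xy) ∷ ≢-sym (~≁⇒≢ xr xy)
            ∷ ~⇒≢ ya ∷ ~⇒≢ yb ∷ [])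
        ∷ (≢-sym (~≁⇒≢ xp xz) ∷ ≢-sym (~≁⇒≢ xq xz) ∷ ≢-sym (~≁⇒≢ xr xz)
            ∷ ≢-sym (~≁⇒≢ ya yz) ∷ ≢-sym (~≁⇒≢ yb yz) ∷ [])
        ∷ (p≢q ∷ p≢r ∷ ~≁⇒≢ xp xa ∷ ~≁⇒≢ xp xb ∷ [])
        ∷ (q≢r ∷ ~≁⇒≢ xq xa ∷ ~≁⇒≢ xq xb ∷ [])
        ∷ (~≁⇒≢ xr xa ∷ ~≁⇒≢ xr xb ∷ [])
        ∷ (a≢b ∷ [])
        ∷ [] ∷ [])

    no-three-hubs : ∀ {x y z} → x ≢ y → x ≢ z → y ≢ z → Hub x → Hub y → Hub z → ⊥
    no-three-hubs {x} {y} {z} x≢y x≢z y≢z hx hy hz with adj? x y | adj? y z | adj? x z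
    ... | yes xy | yes yz | yes xz = no-triangle xy yz (~-sym xz)
    ... | yes xy | yes yz | no xz  = hubs-on-path xy yz (¬~⇒≁ xz) x≢z hx hy hz
    ... | yes xy | no yz  | yes xz = hubs-on-path (~-sym xy) xz (¬~⇒≁ yz) y≢z hy hx hz
    ... | no xy  | yes yz | yes xz = hubs-on-path xz (~-sym yz) (¬~⇒≁ xy) x≢y hx hz hy
    ... | yes xy | no yz  | no xz  = hubs-edge-apart xy (¬~⇒≁ xz) (¬~⇒≁ yz) x≢z y≢z hx hy hz
    ... | no xy  | yes yz | no xz  =
      hubs-edge-apart yz (≁-sym (¬~⇒≁ xy)) (≁-sym (¬~⇒≁ xz)) (≢-sym x≢y) (≢-sym x≢z) hy hz hx
    ... | no xy  | no yz  | yes xz =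
      hubs-edge-apart xz (¬~⇒≁ xy) (≁-sym (¬~⇒≁ yz)) x≢y (≢-sym y≢z) hx hz hy
    ... | no xy  | no yz  | no xz  =
      hubs-apart (¬~⇒≁ xy) (¬~⇒≁ xz) (¬~⇒≁ yz) x≢y x≢z y≢z hx hy hz

    hub-classification : Fin n →
      (Σ (Fin n) λ h → ∀ v → v ≢ h → DegAtMost2 v) ⊎
      (Σ (Fin n) λ h₁ → Σ (Fin n) λ h₂ → h₁ ≢ h₂ × Hub h₁ × Hub h₂ ×
        (∀ v → v ≢ h₁ → v ≢ h₂ → DegAtMost2 v))
    hub-classification v₀ with any? hub?
    ... | no none = inj₁ (v₀ , λ v _ → ¬hub⇒deg2 (λ hv → none (v , hv)))
    ... | yes (h₁ , hub₁) with any? (λ h → ¬? (h ≟ h₁) ×-dec hub? h)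
    ...   | no none = inj₁ (h₁ , λ v v≢h₁ → ¬hub⇒deg2 (λ hv → none (v , v≢h₁ , hv)))
    ...   | yes (h₂ , h₂≢h₁ , hub₂) = inj₂ (h₁ , h₂ , ≢-sym h₂≢h₁ , hub₁ , hub₂ , low)
      where
      low : ∀ v → v ≢ h₁ → v ≢ h₂ → DegAtMost2 v
      low v v≢h₁ v≢h₂ = ¬hub⇒deg2 λ hv →
        no-three-hubs (≢-sym h₂≢h₁) (≢-sym v≢h₁) (≢-sym v≢h₂) hub₁ hub₂ hv

module Game {n : ℕ} (G : Graph n) where
  open Adjacency G

  Col : Set
  Col = Coloring n 3

  just⇒≢nothing : ∀ {m : Maybe (Fin 3)} {z} → m ≡ just z → m ≢ nothing
  just⇒≢nothing refl ()

  colour? : (m : Maybe (Fin 3)) → Dec (∃ λ z → m ≡ just z)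
  colour? nothing  = no λ { (_ , ()) }
  colour? (just z) = yes (z , refl)

  uncoloured? : (m : Maybe (Fin 3)) → Dec (m ≡ nothing)
  uncoloured? nothing  = yes refl
  uncoloured? (just _) = no λ ()

  _⊑_ : Col → Col → Set
  c ⊑ c' = ∀ w a → c w ≡ just a → c' w ≡ just a

  update-here : ∀ (c : Col) v a → update c v a v ≡ just a
  update-here c v a with v ≟ v
  ... | yes _  = refl
  ... | no v≢v = ⊥-elim (v≢v refl)

  update-there : ∀ (c : Col) {v w} a → w ≢ v → update c v a w ≡ c w
  update-there c {v} {w} a w≢v with w ≟ v
  ... | yes w≡v = ⊥-elim (w≢v w≡v)
  ... | no _    = refl

  update-inv : ∀ (c : Col) v a u z → update c v a u ≡ just z → (u ≡ v × a ≡ z) ⊎ c u ≡ just z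
  update-inv c v a u z cu with u ≟ v
  ... | yes u≡v = inj₁ (u≡v , just-injective cu)
  ... | no _    = inj₂ cu

  ⊑-update : ∀ (c : Col) {v} a → c v ≡ nothing → c ⊑ update c v a
  ⊑-update c {v} a cv w b cw with w ≟ v
  ... | yes refl = ⊥-elim (just⇒≢nothing cw cv)
  ... | no _     = cw

  ⊑-uncoloured : ∀ {c c' : Col} → c ⊑ c' → ∀ {v} → c' v ≡ nothing → c v ≡ nothing
  ⊑-uncoloured {c} c⊑c' {v} c'v with c v in cv
  ... | nothing = refl
  ... | just a  = ⊥-elim (just⇒≢nothing (c⊑c' v a cv) c'v)

  uncoloured-after-update : ∀ (c : Col) {v u} a → update c v a u ≡ nothing → u ≢ v
  uncoloured-after-update c {v} a cu refl = just⇒≢nothing (update-here c v a) cu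

  avoid-two : (a b : Fin 3) → Σ (Fin 3) λ c → a ≢ c × b ≢ c
  avoid-two zero             zero             = suc zero , (λ ()) , (λ ())
  avoid-two zero             (suc zero)       = suc (suc zero) , (λ ()) , (λ ())
  avoid-two zero             (suc (suc zero)) = suc zero , (λ ()) , (λ ())
  avoid-two (suc zero)       zero             = suc (suc zero) , (λ ()) , (λ ())
  avoid-two (suc zero)       (suc zero)       = zero , (λ ()) , (λ ())
  avoid-two (suc zero)       (suc (suc zero)) = zero , (λ ()) , (λ ())
  avoid-two (suc (suc zero)) zero             = suc zero , (λ ()) , (λ ())
  avoid-two (suc (suc zero)) (suc zero)       = zero , (λ ()) , (λ ())
  avoid-two (suc (suc zero)) (suc (suc zero)) = zero , (λ ()) , (λ ())

  avoid-two-slots : (m₁ m₂ : Maybe (Fin 3)) → Σ (Fin 3) λ c → m₁ ≢ just c × m₂ ≢ just c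
  avoid-two-slots m₁ m₂ with avoid-two (fromMaybe zero m₁) (fromMaybe zero m₂)
  ... | c , m₁≢c , m₂≢c = c , avoids m₁ m₁≢c , avoids m₂ m₂≢c
    where
    avoids : ∀ m → fromMaybe zero m ≢ c → m ≢ just c
    avoids nothing  _   ()
    avoids (just a) a≢c m≡c = a≢c (just-injective m≡c)

  -- v is safe in c: apart from two vertices x, y, every neighbour of v is
  -- coloured with a colour already on x or y.  Then at most two colours
  -- occur around v, and this persists in every extension of c.
  Safe : Col → Fin n → Set
  Safe c v = Σ (Fin n) λ x → Σ (Fin n) λ y → ∀ u → v ~ u →
    (u ≡ x ⊎ u ≡ y) ⊎ (Σ (Fin 3) λ a → c u ≡ just a × (c x ≡ just a ⊎ c y ≡ just a))

  safe-⊑ : ∀ {c c' : Col} → c ⊑ c' → ∀ {v} → Safe c v → Safe c' v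
  safe-⊑ {c} {c'} c⊑c' {v} (x , y , nbrs) = x , y , nbrs'
    where
    nbrs' : ∀ u → v ~ u →
      (u ≡ x ⊎ u ≡ y) ⊎ (Σ (Fin 3) λ a → c' u ≡ just a × (c' x ≡ just a ⊎ c' y ≡ just a))
    nbrs' u vu with nbrs u vu
    ... | inj₁ u∈xy                 = inj₁ u∈xy
    ... | inj₂ (a , cu , inj₁ cx)   = inj₂ (a , c⊑c' u a cu , inj₁ (c⊑c' x a cx))
    ... | inj₂ (a , cu , inj₂ cy)   = inj₂ (a , c⊑c' u a cu , inj₂ (c⊑c' y a cy))

  deg2⇒safe : ∀ {c : Col} {v} → DegAtMost2 v → Safe c v
  deg2⇒safe (x , y , nbrs) = x , y , λ u vu → inj₁ (nbrs u vu)

  -- A safe vertex has a legal colour: any colour missing on x and y.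
  safe⇒legal : ∀ {c : Col} {v} → Safe c v → ∃ λ a → Legal G c v a
  safe⇒legal {c} {v} (x , y , nbrs) with avoid-two-slots (c x) (c y)
  ... | a , cx≢a , cy≢a = a , legal
    where
    legal : Legal G c v a
    legal u vu cu with nbrs u vu
    ... | inj₁ (inj₁ refl)            = cx≢a cu
    ... | inj₁ (inj₂ refl)            = cy≢a cu
    ... | inj₂ (b , cub , inj₁ cx)    = cx≢a (trans cx (trans (≡-sym cub) cu))
    ... | inj₂ (b , cub , inj₂ cy)    = cy≢a (trans cy (trans (≡-sym cub) cu))

  NearColour : Col → Fin n → Fin 3 → Set
  NearColour c h a = ∀ u → h ~ u → ∀ z → c u ≡ just z → z ≡ a

  OneColourNear : Col → Fin n → Set
  OneColourNear c h = Σ (Fin 3) (NearColour c h)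

  TwoColoursNear : Col → Fin n → Set
  TwoColoursNear c h = Σ (Fin 3) λ a → Σ (Fin 3) λ a' →
    ∀ u → h ~ u → ∀ z → c u ≡ just z → z ≡ a ⊎ z ≡ a'

  NoColouredNbr : Col → Fin n → Set
  NoColouredNbr c h = ∀ u → h ~ u → c u ≡ nothing

  two-colours⇒legal : ∀ {c : Col} {h} → TwoColoursNear c h → ∃ λ a → Legal G c h a
  two-colours⇒legal {c} {h} (a , a' , near) with avoid-two a a'
  ... | b , a≢b , a'≢b = b , legal
    where
    legal : Legal G c h b
    legal u hu cu with near u hu b cu
    ... | inj₁ b≡a  = a≢b (≡-sym b≡a)
    ... | inj₂ b≡a' = a'≢b (≡-sym b≡a')

  one⇒two : ∀ {c : Col} {h} → OneColourNear c h → TwoColoursNear c h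
  one⇒two (a , near) = a , a , λ u hu z cu → inj₁ (near u hu z cu)

  one-colour-update : ∀ {c : Col} {h} → OneColourNear c h → ∀ w b → TwoColoursNear (update c w b) h
  one-colour-update {c} {h} (a , near) w b = a , b , near'
    where
    near' : ∀ u → h ~ u → ∀ z → update c w b u ≡ just z → z ≡ a ⊎ z ≡ b
    near' u hu z cu with update-inv c w b u z cu
    ... | inj₁ (_ , b≡z) = inj₂ (≡-sym b≡z)
    ... | inj₂ cu'       = inj₁ (near u hu z cu')

  near-update : ∀ {c : Col} {h a} → NearColour c h a → ∀ {w x} → (h ~ w → x ≡ a) →
    NearColour (update c w x) h a
  near-update {c} near {w} {x} x≡a u hu z cu with update-inv c w x u z cu
  ... | inj₁ (refl , x≡z) = trans (≡-sym x≡z) (x≡a hu)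
  ... | inj₂ cu'          = near u hu z cu'

  no-coloured-nbr⇒near : ∀ {c : Col} {h} → NoColouredNbr c h → ∀ a → NearColour c h a
  no-coloured-nbr⇒near none a u hu z cu = ⊥-elim (just⇒≢nothing cu (none u hu))

  coloured-nbr? : ∀ (c : Col) h → NoColouredNbr c h ⊎ (Σ (Fin n) λ u → h ~ u × ∃ λ z → c u ≡ just z)
  coloured-nbr? c h with any? (λ u → adj? h u ×-dec colour? (c u))
  ... | yes found = inj₂ found
  ... | no none   = inj₁ uncoloured
    where
    uncoloured : NoColouredNbr c h
    uncoloured u hu with c u in cu
    ... | nothing = refl
    ... | just z  = ⊥-elim (none (u , hu , z , cu))

  AllSafe : Col → Set
  AllSafe c = ∀ v → c v ≡ nothing → Safe c v

  SafeExcept : Col → Fin n → Set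
  SafeExcept c h = ∀ v → c v ≡ nothing → v ≢ h → Safe c v

  SafeExcept₂ : Col → Fin n → Fin n → Set
  SafeExcept₂ c h h' = ∀ v → c v ≡ nothing → v ≢ h → v ≢ h' → Safe c v

  allSafe-update : ∀ {c : Col} {v} a → c v ≡ nothing → AllSafe c → AllSafe (update c v a)
  allSafe-update {c} a cv safe u cu =
    safe-⊑ (⊑-update c a cv) (safe u (⊑-uncoloured (⊑-update c a cv) cu))

  safeExcept-update : ∀ {c : Col} {h w} b → c w ≡ nothing → SafeExcept c h → SafeExcept (update c w b) h
  safeExcept-update {c} b cw safe v cv v≢h =
    safe-⊑ (⊑-update c b cw) (safe v (⊑-uncoloured (⊑-update c b cw) cv) v≢h)

  safeExcept₂-⊑ : ∀ {c c' : Col} {h h'} → c ⊑ c' → SafeExcept₂ c h h' → SafeExcept₂ c' h h'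
  safeExcept₂-⊑ c⊑c' safe v cv v≢h v≢h' = safe-⊑ c⊑c' (safe v (⊑-uncoloured c⊑c' cv) v≢h v≢h')

  safeExcept₂-swap : ∀ {c : Col} {h h'} → SafeExcept₂ c h h' → SafeExcept₂ c h' h
  safeExcept₂-swap safe v cv v≢h' v≢h = safe v cv v≢h v≢h'

  colour-exception : ∀ {c : Col} {h h'} x → c h ≡ nothing → SafeExcept₂ c h h' →
    SafeExcept (update c h x) h'
  colour-exception {c} x ch safe v cv v≢h' =
    safe-⊑ (⊑-update c x ch)
      (safe v (⊑-uncoloured (⊑-update c x ch) cv) (uncoloured-after-update c x cv) v≢h')

  colour-last-exception : ∀ {c : Col} {h} x → c h ≡ nothing → SafeExcept c h → AllSafe (update c h x)
  colour-last-exception {c} x ch safe v cv =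
    safe-⊑ (⊑-update c x ch)
      (safe v (⊑-uncoloured (⊑-update c x ch) cv) (uncoloured-after-update c x cv))

  -- Number of uncoloured vertices, the termination measure of the game.
  blank : Maybe (Fin 3) → ℕ
  blank nothing  = 1
  blank (just _) = 0

  blanksIn : Col → List (Fin n) → ℕ
  blanksIn c []       = 0
  blanksIn c (v ∷ vs) = blank (c v) + blanksIn c vs

  blanks : Col → ℕ
  blanks c = blanksIn c (allFin n)

  blank-⊑ : ∀ {c c' : Col} → c ⊑ c' → ∀ w → blank (c' w) ≤ blank (c w)
  blank-⊑ {c} {c'} c⊑c' w with c w in cw | c' w in c'w
  ... | nothing | nothing = s≤s z≤n
  ... | nothing | just _  = z≤n
  ... | just a  | nothing = ⊥-elim (just⇒≢nothing (c⊑c' w a cw) c'w)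
  ... | just _  | just _  = z≤n

  blanksIn-⊑ : ∀ {c c' : Col} → c ⊑ c' → ∀ vs → blanksIn c' vs ≤ blanksIn c vs
  blanksIn-⊑ c⊑c' []       = z≤n
  blanksIn-⊑ c⊑c' (v ∷ vs) = +-mono-≤ (blank-⊑ c⊑c' v) (blanksIn-⊑ c⊑c' vs)

  blanksIn-colour : ∀ {c c' : Col} → c ⊑ c' → ∀ {w z} vs → w ∈ vs →
    c w ≡ nothing → c' w ≡ just z → blanksIn c' vs < blanksIn c vs
  blanksIn-colour {c} {c'} c⊑c' (v ∷ vs) (here refl) cw c'w
    rewrite cw | c'w = s≤s (blanksIn-⊑ c⊑c' vs)
  blanksIn-colour c⊑c' (v ∷ vs) (there w∈vs) cw c'w =
    +-mono-≤-< (blank-⊑ c⊑c' v) (blanksIn-colour c⊑c' vs w∈vs cw c'w)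

  blanks-update : ∀ (c : Col) v a → c v ≡ nothing → blanks (update c v a) < blanks c
  blanks-update c v a cv =
    blanksIn-colour (⊑-update c a cv) (allFin n) (∈-allFin v) cv (update-here c v a)

  uncoloured-vertex? : (c : Col) → Dec (∃ λ v → c v ≡ nothing)
  uncoloured-vertex? c = any? (λ v → uncoloured? (c v))

  complete : ∀ {c : Col} → ¬ (∃ λ v → c v ≡ nothing) → Complete c
  complete none v cv = none (v , cv)

  incomplete : ∀ {c : Col} {v} → c v ≡ nothing → ¬ Complete c
  incomplete cv full = full _ cv

  -- Once all uncoloured vertices are safe, Alice wins whoever moves:
  -- nobody can create a dead vertex, and every move colours a vertex.
  safe-play : ∀ k (c : Col) → blanks c < k → AllSafe c → AliceWinsA G c × AliceWinsB G c
  safe-play (suc k) c bound safe with uncoloured-vertex? c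
  ... | no none = doneA (complete none) , doneB (complete none)
  ... | yes (v , cv) =
    aliceMoves , bobTurn (incomplete cv) noDead aliceMoves (λ w b cw _ → proj₁ (next w b cw))
    where
    noDead : NoDead G c
    noDead u cu = safe⇒legal (safe u cu)
    next : ∀ w b → c w ≡ nothing → AliceWinsA G (update c w b) × AliceWinsB G (update c w b)
    next w b cw = safe-play k (update c w b)
      (<-≤-trans (blanks-update c w b cw) (≤-pred bound)) (allSafe-update b cw safe)
    aliceMoves : AliceWinsA G c
    aliceMoves with safe⇒legal (safe v cv)
    ... | a , legal = move noDead v a cv legal (proj₂ (next v a cv))

  allSafe⇒winsA : ∀ {c : Col} → AllSafe c → AliceWinsA G c
  allSafe⇒winsA {c} safe = proj₁ (safe-play (suc (blanks c)) c (n<1+n _) safe)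

  allSafe⇒winsB : ∀ {c : Col} → AllSafe c → AliceWinsB G c
  allSafe⇒winsB {c} safe = proj₂ (safe-play (suc (blanks c)) c (n<1+n _) safe)

  noDead-except : ∀ {c : Col} {h} → SafeExcept c h → TwoColoursNear c h → NoDead G c
  noDead-except {h = h} safe two v cv with v ≟ h
  ... | yes refl = two-colours⇒legal two
  ... | no v≢h   = safe⇒legal (safe v cv v≢h)

  colour-hub : ∀ {c : Col} {h} → SafeExcept c h → TwoColoursNear c h → AliceWinsA G c
  colour-hub {c} {h} safe two with uncoloured? (c h)
  ... | no ch≢nothing = allSafe⇒winsA λ v cv → safe v cv λ { refl → ch≢nothing cv }
  ... | yes ch with two-colours⇒legal two
  ...   | a , legal = move (noDead-except safe two) h a ch legal
                         (allSafe⇒winsB (colour-last-exception a ch safe))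

  -- Bob to move, h sees one colour: after his move (or pass) h sees at most
  -- two, and Alice colours h.
  guard-hub : ∀ {c : Col} {h} → SafeExcept c h → OneColourNear c h → AliceWinsB G c
  guard-hub {c} {h} safe one with uncoloured-vertex? c
  ... | no none = doneB (complete none)
  ... | yes (v , cv) =
    bobTurn (incomplete cv) (noDead-except safe two) (colour-hub safe two)
      λ w b cw _ → colour-hub (safeExcept-update b cw safe) (one-colour-update one w b)
    where
    two : TwoColoursNear c h
    two = one⇒two one

  colour-and-guard : ∀ {c : Col} {h h' a} x → NoDead G c → SafeExcept₂ c h h' → c h ≡ nothing →
    Legal G c h x → NearColour (update c h x) h' a → AliceWinsA G c
  colour-and-guard x noDead safe ch legal near =
    move noDead _ x ch legal (guard-hub (colour-exception x ch safe) (_ , near))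

  colour-apart-and-guard : ∀ {c : Col} {h h' a} → NoDead G c → SafeExcept₂ c h h' →
    c h ≡ nothing → ¬ (h' ~ h) → NearColour c h' a → AliceWinsA G c
  colour-apart-and-guard {h = h} noDead safe ch h'≁h near with noDead h ch
  ... | x , legal = colour-and-guard x noDead safe ch legal (near-update near λ h'h → ⊥-elim (h'≁h h'h))

  colour-beside-bare-and-guard : ∀ {c : Col} {h h'} → NoDead G c → SafeExcept₂ c h h' →
    c h ≡ nothing → NoColouredNbr c h' → AliceWinsA G c
  colour-beside-bare-and-guard {h = h} noDead safe ch bare with noDead h ch
  ... | x , legal = colour-and-guard x noDead safe ch legal
                      (near-update (no-coloured-nbr⇒near bare x) λ _ → refl)

  bare⇒legal : ∀ {c : Col} {h} → NoColouredNbr c h → ∀ x → Legal G c h x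
  bare⇒legal bare x u hu cu = just⇒≢nothing cu (bare u hu)

  drop-coloured-exception : ∀ {c : Col} {h h'} → c h ≢ nothing → SafeExcept₂ c h h' → SafeExcept c h'
  drop-coloured-exception ch safe v cv v≢h' = safe v cv (λ { refl → ch cv }) v≢h'

  all-near : ∀ {c : Col} {A} → (∀ v z → c v ≡ just z → z ≡ A) → ∀ h → NearColour c h A
  all-near onlyA h u _ z cu = onlyA u z cu

  near⇒legal : ∀ {c : Col} {h a x} → NearColour c h a → a ≢ x → Legal G c h x
  near⇒legal near a≢x u hu cu = a≢x (≡-sym (near u hu _ cu))

  single-colour : ∀ {c : Col} → AtMostOneColored c → Σ (Fin 3) λ A → ∀ v z → c v ≡ just z → z ≡ A
  single-colour {c} one with any? (λ v → colour? (c v))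
  ... | no none = zero , λ v z cv → ⊥-elim (none (v , z , cv))
  ... | yes (v₀ , A , cv₀) = A , same
    where
    same : ∀ v z → c v ≡ just z → z ≡ A
    same v z cv with one v v₀ (just⇒≢nothing cv) (just⇒≢nothing cv₀)
    ... | refl = just-injective (trans (≡-sym cv) cv₀)

  coloured-after-update : ∀ (c : Col) w b u → update c w b u ≢ nothing → u ≡ w ⊎ c u ≢ nothing
  coloured-after-update c w b u coloured with u ≟ w
  ... | yes u≡w = inj₁ u≡w
  ... | no _    = inj₂ coloured

  two-coloured-cover : ∀ {c : Col} → AtMostOneColored c → ∀ w b {p q} → p ≢ q →
    update c w b p ≢ nothing → update c w b q ≢ nothing →
    ∀ u z → update c w b u ≡ just z → u ≡ p ⊎ u ≡ q
  two-coloured-cover {c} one w b {p} {q} p≢q cp cq u z cu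
    with coloured-after-update c w b p cp | coloured-after-update c w b q cq
       | coloured-after-update c w b u (just⇒≢nothing cu)
  ... | inj₁ p≡w  | inj₁ q≡w  | _         = ⊥-elim (p≢q (trans p≡w (≡-sym q≡w)))
  ... | inj₁ p≡w  | inj₂ _    | inj₁ u≡w  = inj₁ (trans u≡w (≡-sym p≡w))
  ... | inj₁ _    | inj₂ c₀q  | inj₂ c₀u  = inj₂ (one u q c₀u c₀q)
  ... | inj₂ _    | inj₁ q≡w  | inj₁ u≡w  = inj₂ (trans u≡w (≡-sym q≡w))
  ... | inj₂ c₀p  | inj₁ _    | inj₂ c₀u  = inj₁ (one u p c₀u c₀p)
  ... | inj₂ c₀p  | inj₂ c₀q  | _         = ⊥-elim (p≢q (one p q c₀p c₀q))

module SpareNeighbour {n : ℕ} (G : Graph n) (acyclic : Acyclic G) where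
  open Adjacency G
  open Forest G acyclic
  open Game G

  -- Alice colours f with col: then
  -- h is safe (besides h' and s it only sees f, which repeats s's colour)
  -- and h' sees only col, so Alice can guard h'.
  spare-nbr-move : ∀ {c : Col} {h h' s t f col} → NoDead G c → SafeExcept₂ c h h' →
    c h ≡ nothing → h ~ h' → h ~ s → h' ~ t → c s ≡ just col → c t ≡ just col →
    (∀ u z → c u ≡ just z → u ≡ s ⊎ u ≡ t) →
    h ~ f → f ≢ h' → f ≢ s → (∀ u → h ~ u → u ≡ h' ⊎ u ≡ s ⊎ u ≡ f) →
    AliceWinsA G c
  spare-nbr-move {c} {h} {h'} {s} {t} {f} {col} noDead safe ch hh' hs h't cs ct cover hf f≢h' f≢s among =
    move noDead f col cf legal (guard-hub safe' (col , near'))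
    where
    c' : Col
    c' = update c f col

    cf : c f ≡ nothing
    cf with c f in cf'
    ... | nothing = refl
    ... | just z with cover f z cf'
    ...   | inj₁ f≡s = ⊥-elim (f≢s f≡s)
    ...   | inj₂ f≡t = ⊥-elim (edge-no-common-nbr hh' hf h't f≡t)

    -- s would close a triangle h s f, t a square t h' h f.
    legal : Legal G c f col
    legal u fu cu with cover u col cu
    ... | inj₁ refl = no-triangle hs (~-sym fu) (~-sym hf)
    ... | inj₂ refl =
      no-square (~-sym h't) (~-sym hh') hf fu (λ { refl → just⇒≢nothing ct ch }) (≢-sym f≢h')

    safe-h : Safe c' h
    safe-h = h' , s , nbrs
      where
      nbrs : ∀ u → h ~ u →
        (u ≡ h' ⊎ u ≡ s) ⊎ (Σ (Fin 3) λ a → c' u ≡ just a × (c' h' ≡ just a ⊎ c' s ≡ just a))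
      nbrs u hu with among u hu
      ... | inj₁ u≡h'          = inj₁ (inj₁ u≡h')
      ... | inj₂ (inj₁ u≡s)    = inj₁ (inj₂ u≡s)
      ... | inj₂ (inj₂ refl)   = inj₂ (col , update-here c f col , inj₂ (⊑-update c col cf s col cs))

    safe' : SafeExcept c' h'
    safe' v c'v v≢h' with v ≟ h
    ... | yes refl = safe-h
    ... | no v≢h   = safe-⊑ (⊑-update c col cf) (safe v (⊑-uncoloured (⊑-update c col cf) c'v) v≢h v≢h')

    near : NearColour c h' col
    near u h'u z cu with cover u z cu
    ... | inj₁ refl = ⊥-elim (edge-no-common-nbr hh' hs h'u refl)
    ... | inj₂ refl = just-injective (trans (≡-sym cu) ct)

    near' : NearColour c' h' col
    near' = near-update near λ h'f → ⊥-elim (edge-no-common-nbr hh' hf h'f refl)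

module TwoHubs {n : ℕ} (G : Graph n) (acyclic : Acyclic G) (small : n ≤ 7)
  (c₀ : Coloring n 3) (one : AtMostOneColored c₀)
  (A : Fin 3) (onlyA : ∀ v z → c₀ v ≡ just z → z ≡ A)
  (h₁ h₂ : Fin n) (h₁≢h₂ : h₁ ≢ h₂)
  (hub₁ : Adjacency.Hub G h₁) (hub₂ : Adjacency.Hub G h₂)
  (low : ∀ v → v ≢ h₁ → v ≢ h₂ → Adjacency.DegAtMost2 G v)
  (c₀h₁ : c₀ h₁ ≡ nothing) (c₀h₂ : c₀ h₂ ≡ nothing) where

  open Adjacency G
  open Forest G acyclic
  open HubCount small using (eight-distinct)
  open Game G
  open SpareNeighbour G acyclic

  noDead₀ : NoDead G c₀
  noDead₀ v _ = two-colours⇒legal (one⇒two (A , all-near onlyA v))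

  safe₀ : SafeExcept₂ c₀ h₁ h₂
  safe₀ v _ v≢h₁ v≢h₂ = deg2⇒safe (low v v≢h₁ v≢h₂)

  bare-away-from : ∀ {h u₀} → c₀ u₀ ≢ nothing → ¬ (h ~ u₀) → NoColouredNbr c₀ h
  bare-away-from {h} {u₀} cu₀ h≁u₀ u hu with c₀ u in cu
  ... | nothing = refl
  ... | just z with one u u₀ (just⇒≢nothing cu) cu₀
  ...   | refl = ⊥-elim (h≁u₀ hu)

  -- Bob passes: Alice colours h₁ so that h₂ still sees a single colour.
  after-pass : AliceWinsA G c₀
  after-pass with adj? h₂ h₁ | coloured-nbr? c₀ h₂
  ... | no h₂≁h₁ | _        = colour-apart-and-guard noDead₀ safe₀ c₀h₁ h₂≁h₁ (all-near onlyA h₂)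
  ... | yes _    | inj₁ bare₂ = colour-beside-bare-and-guard noDead₀ safe₀ c₀h₁ bare₂
  ... | yes h₂h₁ | inj₂ (u₀ , h₂u₀ , _ , cu₀) =
    colour-and-guard A noDead₀ safe₀ c₀h₁ (bare⇒legal bare₁ A)
      (near-update (all-near onlyA h₂) λ _ → refl)
    where
    bare₁ : NoColouredNbr c₀ h₁
    bare₁ = bare-away-from (just⇒≢nothing cu₀) λ h₁u₀ → no-triangle h₁u₀ (~-sym h₂u₀) h₂h₁

  module BobColours (w : Fin n) (b : Fin 3) (c₀w : c₀ w ≡ nothing) where

    c₁ : Col
    c₁ = update c₀ w b

    noDead₁ : NoDead G c₁
    noDead₁ v _ = two-colours⇒legal (one-colour-update (A , all-near onlyA v) w b)

    safe₁ : SafeExcept₂ c₁ h₁ h₂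
    safe₁ = safeExcept₂-⊑ (⊑-update c₀ b c₀w) safe₀

    still-uncoloured : ∀ {h} → c₀ h ≡ nothing → w ≢ h → c₁ h ≡ nothing
    still-uncoloured c₀h w≢h = trans (update-there c₀ b (≢-sym w≢h)) c₀h

    near-far : ∀ {h} → ¬ (h ~ w) → NearColour c₁ h A
    near-far h≁w = near-update (all-near onlyA _) λ hw → ⊥-elim (h≁w hw)

    near-bare : ∀ {h} → NoColouredNbr c₀ h → NearColour c₁ h b
    near-bare bare = near-update (no-coloured-nbr⇒near bare b) λ _ → refl

    on-hub : ∀ {h h'} → SafeExcept₂ c₁ h h' → w ≡ h → AliceWinsA G c₁
    on-hub {h} {h'} safe refl =
      colour-hub (drop-coloured-exception (just⇒≢nothing (update-here c₀ w b)) safe)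
                 (one-colour-update (A , all-near onlyA h') w b)

    -- Non-adjacent hubs: colour one hub, the other keeps a single colour.
    module Apart (w≢h₁ : w ≢ h₁) (w≢h₂ : w ≢ h₂) (h₁≁h₂ : ¬ (h₁ ~ h₂)) where

      guard₁ : ∀ {a} → NearColour c₁ h₁ a → AliceWinsA G c₁
      guard₁ = colour-apart-and-guard noDead₁ (safeExcept₂-swap safe₁)
                 (still-uncoloured c₀h₂ w≢h₂) h₁≁h₂

      guard₂ : ∀ {a} → NearColour c₁ h₂ a → AliceWinsA G c₁
      guard₂ = colour-apart-and-guard noDead₁ safe₁
                 (still-uncoloured c₀h₁ w≢h₁) λ h₂h₁ → h₁≁h₂ (~-sym h₂h₁)

      -- If both hubs see w, the precoloured vertex cannot see both (square).
      win : AliceWinsA G c₁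
      win with adj? h₁ w | adj? h₂ w | coloured-nbr? c₀ h₂
      ... | no h₁≁w | _       | _          = guard₁ (near-far h₁≁w)
      ... | yes _   | no h₂≁w | _          = guard₂ (near-far h₂≁w)
      ... | yes _   | yes _   | inj₁ bare₂ = guard₂ (near-bare bare₂)
      ... | yes h₁w | yes h₂w | inj₂ (u₀ , h₂u₀ , _ , cu₀) =
        guard₁ (near-bare (bare-away-from (just⇒≢nothing cu₀) λ h₁u₀ →
          no-square h₁w (~-sym h₂w) h₂u₀ (~-sym h₁u₀) h₁≢h₂ λ { refl → just⇒≢nothing cu₀ c₀w }))

    module Adjacent (w≢h₁ : w ≢ h₁) (w≢h₂ : w ≢ h₂) (h₁h₂ : h₁ ~ h₂) where

      c₁h₁ : c₁ h₁ ≡ nothing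
      c₁h₁ = still-uncoloured c₀h₁ w≢h₁

      c₁h₂ : c₁ h₂ ≡ nothing
      c₁h₂ = still-uncoloured c₀h₂ w≢h₂

      -- Each hub sees a coloured vertex: p ~ h₁ of colour zp, q ~ h₂ of
      -- colour zq.  These are the only coloured vertices.
      module BothSee (p : Fin n) (h₁p : h₁ ~ p) (zp : Fin 3) (cp : c₁ p ≡ just zp)
                     (q : Fin n) (h₂q : h₂ ~ q) (zq : Fin 3) (cq : c₁ q ≡ just zq) where

        cover : ∀ u z → c₁ u ≡ just z → u ≡ p ⊎ u ≡ q
        cover = two-coloured-cover one w b (edge-no-common-nbr h₁h₂ h₁p h₂q)
                  (just⇒≢nothing cp) (just⇒≢nothing cq)

        near₁ : NearColour c₁ h₁ zp
        near₁ u h₁u z cu with cover u z cu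
        ... | inj₁ refl = just-injective (trans (≡-sym cu) cp)
        ... | inj₂ refl = ⊥-elim (edge-no-common-nbr h₁h₂ h₁u h₂q refl)

        near₂ : NearColour c₁ h₂ zq
        near₂ u h₂u z cu with cover u z cu
        ... | inj₁ refl = ⊥-elim (edge-no-common-nbr h₁h₂ h₁p h₂u refl)
        ... | inj₂ refl = just-injective (trans (≡-sym cu) cq)

        -- Different colours: colour h₂ with zp, so that h₁ sees only zp.
        distinct-colours : zq ≢ zp → AliceWinsA G c₁
        distinct-colours zq≢zp =
          colour-and-guard zp noDead₁ (safeExcept₂-swap safe₁) c₁h₂ (near⇒legal near₂ zq≢zp)
            (near-update near₁ λ _ → refl)

        -- Same colour: a hub of degree exactly three lets Alice play its
        -- spare neighbour; if both had degree four, the two hubs and their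
        -- neighbours would be eight distinct vertices.
        same-colour : zp ≡ zq → AliceWinsA G c₁
        same-colour refl with nbr-avoiding₂ hub₁ h₂ p | nbr-avoiding₂ hub₂ h₁ q
        ... | f₁ , h₁f₁ , f₁≢h₂ , f₁≢p | f₂ , h₂f₂ , f₂≢h₁ , f₂≢q
          with nbrs-among₃ h₁ h₂ p f₁ | nbrs-among₃ h₂ h₁ q f₂
        ... | inj₁ among₁ | _ =
          spare-nbr-move noDead₁ safe₁ c₁h₁ h₁h₂ h₁p h₂q cp cq cover h₁f₁ f₁≢h₂ f₁≢p among₁
        ... | inj₂ _ | inj₁ among₂ =
          spare-nbr-move noDead₁ (safeExcept₂-swap safe₁) c₁h₂ (~-sym h₁h₂) h₂q h₁p cq cp
            (λ u z cu → swap (cover u z cu)) h₂f₂ f₂≢h₁ f₂≢q among₂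
        ... | inj₂ (g₁ , h₁g₁ , g₁≢h₂ , g₁≢p , g₁≢f₁) | inj₂ (g₂ , h₂g₂ , g₂≢h₁ , g₂≢q , g₂≢f₂) =
          ⊥-elim (eight-distinct {h₁} {h₂} {p} {f₁} {g₁} {q} {f₂} {g₂}
            ( (~⇒≢ h₁h₂ ∷ ~⇒≢ h₁p ∷ ~⇒≢ h₁f₁ ∷ ~⇒≢ h₁g₁
                ∷ (λ { refl → just⇒≢nothing cq c₁h₁ }) ∷ ≢-sym f₂≢h₁ ∷ ≢-sym g₂≢h₁ ∷ [])
            ∷ ((λ { refl → just⇒≢nothing cp c₁h₂ }) ∷ ≢-sym f₁≢h₂ ∷ ≢-sym g₁≢h₂
                ∷ ~⇒≢ h₂q ∷ ~⇒≢ h₂f₂ ∷ ~⇒≢ h₂g₂ ∷ [])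
            ∷ (≢-sym f₁≢p ∷ ≢-sym g₁≢p ∷ across h₁p h₂q ∷ across h₁p h₂f₂ ∷ across h₁p h₂g₂ ∷ [])
            ∷ (≢-sym g₁≢f₁ ∷ across h₁f₁ h₂q ∷ across h₁f₁ h₂f₂ ∷ across h₁f₁ h₂g₂ ∷ [])
            ∷ (across h₁g₁ h₂q ∷ across h₁g₁ h₂f₂ ∷ across h₁g₁ h₂g₂ ∷ [])
            ∷ (≢-sym f₂≢q ∷ ≢-sym g₂≢q ∷ [])
            ∷ (≢-sym g₂≢f₂ ∷ [])
            ∷ [] ∷ []))
          where
          across : ∀ {x y} → h₁ ~ x → h₂ ~ y → x ≢ y
          across = edge-no-common-nbr h₁h₂

      -- A hub without coloured neighbours is guarded by colouring the other.
      win : AliceWinsA G c₁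
      win with coloured-nbr? c₁ h₁ | coloured-nbr? c₁ h₂
      ... | inj₁ bare₁ | _ = colour-beside-bare-and-guard noDead₁ (safeExcept₂-swap safe₁) c₁h₂ bare₁
      ... | inj₂ _ | inj₁ bare₂ = colour-beside-bare-and-guard noDead₁ safe₁ c₁h₁ bare₂
      ... | inj₂ (p , h₁p , zp , cp) | inj₂ (q , h₂q , zq , cq) with zp ≟ zq
      ...   | yes zp≡zq = BothSee.same-colour p h₁p zp cp q h₂q zq cq zp≡zq
      ...   | no zp≢zq  = BothSee.distinct-colours p h₁p zp cp q h₂q zq cq (≢-sym zp≢zq)

    after-move : AliceWinsA G c₁
    after-move with w ≟ h₁ | w ≟ h₂ | adj? h₁ h₂
    ... | yes w≡h₁ | _        | _        = on-hub safe₁ w≡h₁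
    ... | no _     | yes w≡h₂ | _        = on-hub (safeExcept₂-swap safe₁) w≡h₂
    ... | no w≢h₁  | no w≢h₂  | yes h₁h₂ = Adjacent.win w≢h₁ w≢h₂ h₁h₂
    ... | no w≢h₁  | no w≢h₂  | no h₁≁h₂ = Apart.win w≢h₁ w≢h₂ h₁≁h₂

  opening : AliceWinsB G c₀
  opening = bobTurn (incomplete c₀h₁) noDead₀ after-pass
    λ w b c₀w _ → BobColours.after-move w b c₀w

lemma5p4 : ∀ (n : ℕ) (G : Graph n) (c : Coloring n 3) →
    IsTreeTrunk G c → AtMostOneColored c → n ≤ 7 →
    AliceWinsModified 3 G c
lemma5p4 zero    G c ((() , _) , _) one small
lemma5p4 (suc m) G c ((_ , _ , acyclic) , _) one small = alice-wins
  where
  open Adjacency G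
  open Forest G acyclic
  open HubCount small using (hub-classification)
  open Game G

  alice-wins : AliceWinsB G c
  alice-wins with single-colour one | hub-classification zero
  ... | A , onlyA | inj₁ (h , low) =
    guard-hub (λ v _ v≢h → deg2⇒safe (low v v≢h)) (A , all-near onlyA h)
  ... | A , onlyA | inj₂ (h₁ , h₂ , h₁≢h₂ , hub₁ , hub₂ , low)
    with uncoloured? (c h₁) | uncoloured? (c h₂)
  ...   | no ch₁  | _      = guard-hub (drop-coloured-exception ch₁ safe) (A , all-near onlyA h₂)
    where
    safe : SafeExcept₂ c h₁ h₂
    safe v _ v≢h₁ v≢h₂ = deg2⇒safe (low v v≢h₁ v≢h₂)
  ...   | yes _   | no ch₂ = guard-hub (drop-coloured-exception ch₂ safe) (A , all-near onlyA h₁)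
    where
    safe : SafeExcept₂ c h₂ h₁
    safe v _ v≢h₂ v≢h₁ = deg2⇒safe (low v v≢h₁ v≢h₂)
  ...   | yes ch₁ | yes ch₂ =
    TwoHubs.opening G acyclic small c one A onlyA h₁ h₂ h₁≢h₂ hub₁ hub₂ low ch₁ ch₂
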